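{- Let $p$ be an odd prime and $w\ge 1$ an integer. Then $p^{w+1}$ divides $2^{p-1}-1$ (i.e. $p$ is a Wieferich prime of order at least $w$) if and only if $p^{w+1}$ is an overpseudoprime to base 2.
   Context: A prime $p$ is a Wieferich prime of order $w\ge1$ if $p^{w+1}$ exactly divides $2^{p-1}-1$ (i.e. $p^{w+1}\mid 2^{p-1}-1$ but $p^{w+2}\nmid 2^{p-1}-1$). For an odd integer $m>1$, $h(m)$ denotes the multiplicative order of 2 modulo $m$. The cyclotomic cosets of 2 modulo $m$ are the orbits of $\{1,2,\ldots,m-1\}$ under $x\mapsto 2x \bmod m$; $r(m)$ is their number. An odd composite number $n$ is called an overpseudoprime to base 2 if $n=r(n)h(n)+1$. -}

module Defs where

open import Data.Nat using (ℕ; zero; suc; _+_; _*_; _∸_; _^_; _≤_; _≤?_; _≟_)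
open import Data.Nat.DivMod using (_%_)
open import Data.Nat.Primality using (Composite)
open import Data.List using (List; []; _∷_; map; filter; length; upTo)
open import Data.List.Relation.Unary.All using (All; all?)
open import Data.Product using (_×_)
open import Relation.Nullary.Decidable using (yes; no)
open import Relation.Binary.PropositionalEquality using (_≡_)

firstOrd : ℕ → List ℕ → ℕ
firstOrd m' [] = 0
firstOrd m' (k ∷ ks) with (2 ^ k) % suc m' ≟ 1 % suc m'
... | yes _ = k
... | no  _ = firstOrd m' ks

-- h(m): multiplicative order of 2 modulo m, i.e. the least k ≥ 1 with
-- 2^k ≡ 1 (mod m).  For odd m > 1 such k exists and k ≤ m, so searching
-- k = 1, …, m in increasing order finds it.  (0 is a junk default when
-- no such k exists, e.g. m even or m = 0; never used in the theorem.)
h : ℕ → ℕ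
h zero = 0
h (suc m') = firstOrd m' (map suc (upTo (suc m')))

coset : ℕ → ℕ → List ℕ
coset zero x = []
coset (suc m') x = map (λ i → (x * 2 ^ i) % suc m') (upTo (h (suc m')))

IsLeader : ℕ → ℕ → Set
IsLeader m x = All (x ≤_) (coset m x)

-- r(m): the number of cyclotomic cosets of 2 modulo m partitioning
-- {1, …, m−1}; each coset is counted once, via its least element
r : ℕ → ℕ
r m = length (filter (λ x → all? (x ≤?_) (coset m x)) (map suc (upTo (m ∸ 1))))

Odd : ℕ → Set
Odd n = n % 2 ≡ 1

OverPseudoprime2 : ℕ → Set
OverPseudoprime2 n = Odd n × Composite n × (n ≡ r n * h n + 1)

{-# OPTIONS --safe #-}
-- Let N = p ^ (w + 1) and d = h(N). Multiplication by 2 permutes the nonzero residues modulo the odd N;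
-- the cyclotomic cosets are its orbits and have at most d elements. The pairs (coset leader, k < d)
-- therefore cover the N − 1 nonzero residues through (L , k) ↦ L · 2 ^ k, so N − 1 ≤ r(N) · d, with
-- equality exactly when no 2 ^ i with 0 < i < d fixes a nonzero residue (the action is free).
-- If p ^ (w + 1) ∣ 2 ^ (p − 1) − 1, then d ∣ p − 1 is prime to p; a fixed x ≠ 0 forces p ∣ 2 ^ i − 1,
-- and lifting the exponent gives d ∣ i · p ^ w, hence d ∣ i: the action is free. Conversely
-- x = p ^ w is fixed by 2 ^ (p − 1) by Fermat, so freeness forces d ∣ p − 1.
module Submission where

open import Defs
import Data.Fin as Fin
open import Data.Fin using (Fin; toℕ; fromℕ<; punchOut; combine; remQuot)
  renaming (_≟_ to _≟ᶠ_)
open import Data.Fin.Properties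
  using ( toℕ-fromℕ<; toℕ<n; toℕ-injective; pigeonhole; injective⇒≤; punchOut-injective
        ; remQuot-combine; combine-remQuot)
open import Data.List using (List; map; filter; upTo; applyUpTo; lookup)
open import Data.List.Properties using (map-applyUpTo)
open import Data.List.Extrema.Nat using (min; min≤xs; argmin-all)
open import Data.List.Membership.Propositional using (_∈_)
open import Data.List.Membership.Propositional.Properties
  using (∈-lookup; ∈-filter⁺; ∈-filter⁻; ∈-map⁺; ∈-map⁻; ∈-upTo⁺; ∈-upTo⁻)
open import Data.List.Relation.Unary.All as All using (All; all?)
import Data.List.Relation.Unary.All.Properties as All
open import Data.List.Relation.Unary.AllPairs using (_∷_)
open import Data.List.Relation.Unary.Any using (index)
open import Data.List.Relation.Unary.Any.Properties using (lookup-index)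
open import Data.List.Relation.Unary.Unique.Propositional using (Unique)
import Data.List.Relation.Unary.Unique.Propositional.Properties as Unique
open import Data.Nat
open import Data.Nat.Properties
open import Data.Nat.DivMod
open import Data.Nat.Divisibility
open import Data.Nat.Coprimality using (Coprime; coprime-divisor; prime⇒coprime)
  renaming (sym to coprime-sym)
open import Data.Nat.Primality
  using (Prime; Composite; euclidsLemma; prime⇒nonZero; prime⇒nonTrivial; composite-≢; ¬prime[0]; ¬prime[1])
open import Data.Nat.Tactic.RingSolver using (solve-∀)
open import Data.Product using (∃-syntax; _×_; _,_; proj₁; proj₂; uncurry′)
open import Data.Sum using (inj₁; inj₂)
open import Function using (_∘_)
open import Function.Bundles using (_⇔_; mk⇔; Equivalence)
open import Relation.Nullary using (¬_; Dec; yes; no; contradiction)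
open import Relation.Binary.PropositionalEquality
open ≡-Reasoning

%-*-congˡ : ∀ {a b} c N .{{_ : NonZero N}} → a % N ≡ b % N → a * c % N ≡ b * c % N
%-*-congˡ {a} {b} c N a≡b = begin
  a * c % N               ≡⟨ %-distribˡ-* a c N ⟩
  a % N * (c % N) % N     ≡⟨ cong (λ z → z * (c % N) % N) a≡b ⟩
  b % N * (c % N) % N     ≡⟨ %-distribˡ-* b c N ⟨
  b * c % N               ∎

%-*-congʳ : ∀ a {b c} N .{{_ : NonZero N}} → b % N ≡ c % N → a * b % N ≡ a * c % N
%-*-congʳ a {b} {c} N b≡c = begin
  a * b % N   ≡⟨ cong (_% N) (*-comm a b) ⟩
  b * a % N   ≡⟨ %-*-congˡ a N b≡c ⟩
  c * a % N   ≡⟨ cong (_% N) (*-comm c a) ⟩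
  a * c % N   ∎

%-^-cong : ∀ {a b} k N .{{_ : NonZero N}} → a % N ≡ b % N → a ^ k % N ≡ b ^ k % N
%-^-cong zero N a≡b = refl
%-^-cong {a} {b} (suc k) N a≡b =
  trans (%-*-congˡ (a ^ k) N a≡b) (%-*-congʳ b N (%-^-cong k N a≡b))

%≡%⇒∣∸ : ∀ {a b} N .{{_ : NonZero N}} → a % N ≡ b % N → N ∣ a ∸ b
%≡%⇒∣∸ {a} {b} N a≡b = divides (a / N ∸ b / N) (begin
  a ∸ b                                      ≡⟨ cong₂ _∸_ (m≡m%n+[m/n]*n a N) (m≡m%n+[m/n]*n b N) ⟩
  (a % N + a / N * N) ∸ (b % N + b / N * N)  ≡⟨ cong (λ z → (z + a / N * N) ∸ (b % N + b / N * N)) a≡b ⟩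
  (b % N + a / N * N) ∸ (b % N + b / N * N)  ≡⟨ [m+n]∸[m+o]≡n∸o (b % N) _ _ ⟩
  a / N * N ∸ b / N * N                      ≡⟨ *-distribʳ-∸ N (a / N) (b / N) ⟨
  (a / N ∸ b / N) * N                        ∎)

∣∸⇒%≡% : ∀ {a b} N .{{_ : NonZero N}} → b ≤ a → N ∣ a ∸ b → a % N ≡ b % N
∣∸⇒%≡% {a} {b} N b≤a N∣a∸b = begin
  a % N              ≡⟨ cong (_% N) (m+[n∸m]≡n b≤a) ⟨
  (b + (a ∸ b)) % N  ≡⟨ %-remove-+ʳ b N∣a∸b ⟩
  b % N              ∎

m*[n∸1]≡m*n∸m : ∀ m n → m * (n ∸ 1) ≡ m * n ∸ m
m*[n∸1]≡m*n∸m m n = trans (*-distribˡ-∸ m n 1) (cong (m * n ∸_) (*-identityʳ m))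

coprime-∣-^* : ∀ {N a} → Coprime N a → ∀ k x → N ∣ a ^ k * x → N ∣ x
coprime-∣-^* c zero x N∣ = subst (_ ∣_) (*-identityˡ x) N∣
coprime-∣-^* {N} {a} c (suc k) x N∣ =
  coprime-∣-^* c k x (coprime-divisor c (subst (N ∣_) (*-assoc a (a ^ k) x) N∣))

odd⇒coprime-2 : ∀ {N} → Odd N → Coprime N 2
odd⇒coprime-2 odd {zero} (_ , 0∣2) with () ← 0∣⇒≡0 0∣2
odd⇒coprime-2 odd {1} _ = refl
odd⇒coprime-2 {N} odd {2} (2∣N , _) with () ← trans (sym (n∣m⇒m%n≡0 N 2 2∣N)) odd
odd⇒coprime-2 odd {suc (suc (suc i))} (_ , i∣2) with s≤s (s≤s ()) ← ∣⇒≤ i∣2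

odd-^ : ∀ {a} k → Odd a → Odd (a ^ k)
odd-^ {a} k odd = trans (%-^-cong k 2 odd) (cong (_% 2) (^-zeroˡ k))

prime^-∣-*-cancelʳ : ∀ {p} → Prime p → ∀ k a b → p ^ k ∣ a * b → ¬ p ∣ b → p ^ k ∣ a
prime^-∣-*-cancelʳ pr zero a b _ _ = 1∣ a
prime^-∣-*-cancelʳ {p} pr (suc k) a b p^k∣ab p∤b with euclidsLemma a b pr (∣-trans (m∣m*n (p ^ k)) p^k∣ab)
... | inj₂ p∣b = contradiction p∣b p∤b
... | inj₁ (divides q refl) = subst (p * p ^ k ∣_) (*-comm p q) (*-monoʳ-∣ p p^k∣q)
  where
  instance _ = prime⇒nonZero pr
  rearrange : ∀ q p b → q * p * b ≡ p * (q * b)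
  rearrange = solve-∀
  p^k∣q : p ^ k ∣ q
  p^k∣q = prime^-∣-*-cancelʳ pr k q b (*-cancelˡ-∣ p (subst (p * p ^ k ∣_) (rearrange q p b) p^k∣ab)) p∤b

∣pred⇒coprime : ∀ {p k} .{{_ : NonZero k}} → Prime p → k ∣ p ∸ 1 → Coprime k p
∣pred⇒coprime {zero} pr _ = contradiction pr ¬prime[0]
∣pred⇒coprime {1} pr _ = contradiction pr ¬prime[1]
∣pred⇒coprime {suc (suc _)} pr k∣ = coprime-sym (prime⇒coprime pr (s≤s (∣⇒≤ k∣)))

0<m<n⇒n∤m : ∀ {m n} → 1 ≤ m → m < n → ¬ n ∣ m
0<m<n⇒n∤m 1≤m m<n n∣m = <⇒≱ m<n (∣⇒≤ {{>-nonZero 1≤m}} n∣m)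

∣∧<⇒≡0 : ∀ {d i} .{{_ : NonZero d}} → d ∣ i → i < d → i ≡ 0
∣∧<⇒≡0 {d} {i} d∣i i<d = trans (sym (m<n⇒m%n≡m i<d)) (n∣m⇒m%n≡0 i d d∣i)

[1+c]^n≡1+n*c+c*c*_ : ∀ c n → ∃[ X ] (1 + c) ^ n ≡ 1 + n * c + c * c * X
[1+c]^n≡1+n*c+c*c*_ c zero = 0 , cong (1 +_) (sym (*-zeroʳ (c * c)))
[1+c]^n≡1+n*c+c*c*_ c (suc n) with X , eq ← [1+c]^n≡1+n*c+c*c*_ c n =
  X + n + c * X , trans (cong ((1 + c) *_) eq) (step c n X)
  where
  step : ∀ c n X → (1 + c) * (1 + n * c + c * c * X) ≡ 1 + (1 + n) * c + c * c * (X + n + c * X)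
  step = solve-∀

-- The binomial expansion modulo c², with c = t · p ^ (e + 1): the linear term gains one factor p.
1+t*p^[1+e]-^p : ∀ p e t → ∃[ t' ] (1 + t * p ^ suc e) ^ p ≡ 1 + t' * p ^ suc (suc e)
1+t*p^[1+e]-^p p e t with X , eq ← [1+c]^n≡1+n*c+c*c*_ (t * (p * p ^ e)) p =
  t + t * t * p ^ e * X , trans eq (regroup p (p ^ e) t X)
  where
  regroup : ∀ p q t X → 1 + p * (t * (p * q)) + t * (p * q) * (t * (p * q)) * X ≡ 1 + (t + t * t * q * X) * (p * (p * q))
  regroup = solve-∀

lift-∣ : ∀ {p a} e → 1 ≤ a → p ∣ a ∸ 1 → p ^ suc e ∣ a ^ (p ^ e) ∸ 1
lift-∣ {p} {a} e 1≤a (divides t a∸1≡t*p) = divides (proj₁ (lift e)) (cong (_∸ 1) (proj₂ (lift e)))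
  where
  lift : ∀ e → ∃[ t' ] a ^ (p ^ e) ≡ 1 + t' * p ^ suc e
  lift zero = t , (begin
    a * 1           ≡⟨ *-identityʳ a ⟩
    a               ≡⟨ m+[n∸m]≡n 1≤a ⟨
    1 + (a ∸ 1)     ≡⟨ cong (1 +_) a∸1≡t*p ⟩
    1 + t * p       ≡⟨ cong (λ z → 1 + t * z) (*-identityʳ p) ⟨
    1 + t * (p * 1) ∎)
  lift (suc e) =
    let t' , eq = lift e
        t'' , eq' = 1+t*p^[1+e]-^p p e t'
    in t'' , (begin
    a ^ (p * p ^ e)         ≡⟨ cong (a ^_) (*-comm p (p ^ e)) ⟩
    a ^ (p ^ e * p)         ≡⟨ ^-*-assoc a (p ^ e) p ⟨
    (a ^ (p ^ e)) ^ p       ≡⟨ cong (_^ p) eq ⟩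
    (1 + t' * p ^ suc e) ^ p ≡⟨ eq' ⟩
    1 + t'' * p ^ suc (suc e) ∎)

surjective⇒≤ : ∀ {a b} (f : Fin a → Fin b) → (∀ y → ∃[ x ] f x ≡ y) → b ≤ a
surjective⇒≤ f surj = injective⇒≤ {f = proj₁ ∘ surj} λ {y} {y'} e →
  trans (sym (proj₂ (surj y))) (trans (cong f e) (proj₂ (surj y')))

-- A section of f that avoids x' injects Fin b into the complement of x'.
surjective∧collision⇒< : ∀ {a b} (f : Fin a → Fin b) → (∀ y → ∃[ x ] f x ≡ y) →
  ∀ {x x'} → x ≢ x' → f x ≡ f x' → b < a
surjective∧collision⇒< {zero} f surj {()}
surjective∧collision⇒< {suc a} {b} f surj {x} {x'} x≢x' fx≡fx' = s≤s (injective⇒≤ {f = g} g-injective)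
  where
  section : ∀ y → ∃[ z ] f z ≡ y × x' ≢ z
  section y with z , fz≡y ← surj y with z ≟ᶠ x'
  ... | yes refl = x , trans fx≡fx' fz≡y , ≢-sym x≢x'
  ... | no z≢x' = z , fz≡y , ≢-sym z≢x'
  s : Fin b → Fin (suc a)
  s y = proj₁ (section y)
  f∘s : ∀ y → f (s y) ≡ y
  f∘s y = proj₁ (proj₂ (section y))
  x'≢s : ∀ y → x' ≢ s y
  x'≢s y = proj₂ (proj₂ (section y))
  g : Fin b → Fin a
  g y = punchOut (x'≢s y)
  g-injective : ∀ {y y'} → g y ≡ g y' → y ≡ y'
  g-injective {y} {y'} e = begin
    y         ≡⟨ f∘s y ⟨
    f (s y)   ≡⟨ cong f (punchOut-injective (x'≢s y) (x'≢s y') e) ⟩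
    f (s y')  ≡⟨ f∘s y' ⟩
    y'        ∎

remQuot-injective : ∀ {a} b {c c' : Fin (a * b)} → remQuot {a} b c ≡ remQuot b c' → c ≡ c'
remQuot-injective {a} b {c} {c'} e = begin
  c                                     ≡⟨ combine-remQuot {a} b c ⟨
  uncurry′ combine (remQuot {a} b c)    ≡⟨ cong (uncurry′ combine) e ⟩
  uncurry′ combine (remQuot {a} b c')   ≡⟨ combine-remQuot {a} b c' ⟩
  c'                                    ∎

lookup-injective : ∀ {xs : List ℕ} → Unique xs → ∀ {i j} → lookup xs i ≡ lookup xs j → i ≡ j
lookup-injective (_ ∷ _) {Fin.zero} {Fin.zero} _ = refl
lookup-injective (x∉xs ∷ _) {Fin.zero} {Fin.suc j} e = contradiction e (All.lookup x∉xs (∈-lookup j))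
lookup-injective (x∉xs ∷ _) {Fin.suc i} {Fin.zero} e = contradiction (sym e) (All.lookup x∉xs (∈-lookup i))
lookup-injective (_ ∷ u) {Fin.suc i} {Fin.suc j} e = cong Fin.suc (lookup-injective u e)

firstOrd-least : ∀ m (f : ℕ → ℕ) K {e} → e < K → 2 ^ f e % suc m ≡ 1 % suc m →
  ∃[ e₀ ] firstOrd m (applyUpTo f K) ≡ f e₀ × 2 ^ f e₀ % suc m ≡ 1 % suc m
    × (∀ {e'} → e' < e₀ → 2 ^ f e' % suc m ≢ 1 % suc m)
firstOrd-least m f (suc K) {e} e<K pe with 2 ^ f 0 % suc m ≟ 1 % suc m
... | yes p₀ = 0 , refl , p₀ , λ ()
... | no ¬p₀ with e
...   | zero = contradiction pe ¬p₀
...   | suc e with e₀ , eq , pe₀ , least ← firstOrd-least m (f ∘ suc) K (s<s⁻¹ e<K) pe =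
  suc e₀ , eq , pe₀ , λ { {zero} _ → ¬p₀ ; {suc e'} e'<e₀ → least (s<s⁻¹ e'<e₀) }

module Order (m : ℕ) (odd : Odd (suc m)) where

  N : ℕ
  N = suc m

  IsPeriod : ℕ → Set
  IsPeriod k = 2 ^ k % N ≡ 1 % N

  2^a≡2^b⇒period : ∀ {a b} → a < b → 2 ^ a % N ≡ 2 ^ b % N → IsPeriod (b ∸ a)
  2^a≡2^b⇒period {a} {b} a<b 2^a≡2^b = ∣∸⇒%≡% N (m^n>0 2 c) N∣2^c∸1
    where
    c = b ∸ a
    2^b∸2^a≡2^a*[2^c∸1] : 2 ^ b ∸ 2 ^ a ≡ 2 ^ a * (2 ^ c ∸ 1)
    2^b∸2^a≡2^a*[2^c∸1] = begin
      2 ^ b ∸ 2 ^ a               ≡⟨ cong (λ z → 2 ^ z ∸ 2 ^ a) (m+[n∸m]≡n (<⇒≤ a<b)) ⟨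
      2 ^ (a + c) ∸ 2 ^ a         ≡⟨ cong (_∸ 2 ^ a) (^-distribˡ-+-* 2 a c) ⟩
      2 ^ a * 2 ^ c ∸ 2 ^ a       ≡⟨ m*[n∸1]≡m*n∸m (2 ^ a) (2 ^ c) ⟨
      2 ^ a * (2 ^ c ∸ 1)         ∎
    N∣2^c∸1 : N ∣ 2 ^ c ∸ 1
    N∣2^c∸1 = coprime-∣-^* (odd⇒coprime-2 odd) a _
      (subst (N ∣_) 2^b∸2^a≡2^a*[2^c∸1] (%≡%⇒∣∸ {2 ^ b} {2 ^ a} N (sym 2^a≡2^b)))

  residueOf2^ : Fin (suc N) → Fin N
  residueOf2^ i = fromℕ< (m%n<n (2 ^ toℕ i) N)

  period-exists : ∃[ c ] 0 < c × c ≤ N × IsPeriod c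
  period-exists with i , j , i<j , rᵢ≡rⱼ ← pigeonhole (n<1+n N) residueOf2^ =
    toℕ j ∸ toℕ i , m<n⇒0<n∸m i<j , ≤-trans (m∸n≤m (toℕ j) (toℕ i)) (s≤s⁻¹ (toℕ<n j)) ,
    2^a≡2^b⇒period i<j (begin
      2 ^ toℕ i % N        ≡⟨ toℕ-fromℕ< (m%n<n (2 ^ toℕ i) N) ⟨
      toℕ (residueOf2^ i)  ≡⟨ cong toℕ rᵢ≡rⱼ ⟩
      toℕ (residueOf2^ j)  ≡⟨ toℕ-fromℕ< (m%n<n (2 ^ toℕ j) N) ⟩
      2 ^ toℕ j % N        ∎)

  -- Kept opaque: unfolding h N, a search through a list, during unification and
  -- instance resolution makes type checking prohibitively slow.
  opaque
    d : ℕ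
    d = h N

    h≡d : h N ≡ d
    h≡d = refl

    h-spec : ∃[ e ] d ≡ suc e × IsPeriod (suc e) × (∀ {e'} → e' < e → ¬ IsPeriod (suc e'))
    h-spec =
      let c , 0<c , c≤N , c-period = period-exists
          suc-pred-c = suc-pred c {{>-nonZero 0<c}}
          e , first≡ , e-period , least =
            firstOrd-least m suc N (subst (_≤ N) (sym suc-pred-c) c≤N) (subst IsPeriod (sym suc-pred-c) c-period)
      in e , trans (cong (firstOrd m) (map-applyUpTo (λ i → i) suc N)) first≡ , e-period , least

  0<h : 0 < d
  0<h = subst (0 <_) (sym (proj₁ (proj₂ h-spec))) z<s

  instance
    h-nonZero : NonZero d
    h-nonZero = >-nonZero 0<h

  h-period : IsPeriod d
  h-period = subst IsPeriod (sym (proj₁ (proj₂ h-spec))) (proj₁ (proj₂ (proj₂ h-spec)))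

  h-least : ∀ {j} → 0 < j → j < d → ¬ IsPeriod j
  h-least {suc j} _ j<d = proj₂ (proj₂ (proj₂ h-spec)) (s<s⁻¹ (subst (suc j <_) (proj₁ (proj₂ h-spec)) j<d))

  2^≡2^[%h] : ∀ j → 2 ^ j % N ≡ 2 ^ (j % d) % N
  2^≡2^[%h] j = begin
    2 ^ j % N                                ≡⟨ cong (λ z → 2 ^ z % N) (m≡m%n+[m/n]*n j d) ⟩
    2 ^ (j % d + j / d * d) % N              ≡⟨ cong (_% N) (^-distribˡ-+-* 2 (j % d) (j / d * d)) ⟩
    2 ^ (j % d) * 2 ^ (j / d * d) % N        ≡⟨ %-*-congʳ (2 ^ (j % d)) N 2^[qd]≡1 ⟩
    2 ^ (j % d) * 1 % N                      ≡⟨ cong (_% N) (*-identityʳ (2 ^ (j % d))) ⟩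
    2 ^ (j % d) % N                          ∎
    where
    2^[qd]≡1 : IsPeriod (j / d * d)
    2^[qd]≡1 = begin
      2 ^ (j / d * d) % N     ≡⟨ cong (λ z → 2 ^ z % N) (*-comm (j / d) d) ⟩
      2 ^ (d * (j / d)) % N   ≡⟨ cong (_% N) (^-*-assoc 2 d (j / d)) ⟨
      (2 ^ d) ^ (j / d) % N   ≡⟨ %-^-cong (j / d) N h-period ⟩
      1 ^ (j / d) % N         ≡⟨ cong (_% N) (^-zeroˡ (j / d)) ⟩
      1 % N                   ∎

  period⇒h∣ : ∀ {j} → IsPeriod j → d ∣ j
  period⇒h∣ {j} j-period with j % d ≟ 0
  ... | yes j%d≡0 = m%n≡0⇒n∣m j d j%d≡0
  ... | no j%d≢0 = contradiction (trans (sym (2^≡2^[%h] j)) j-period) (h-least (n≢0⇒n>0 j%d≢0) (m%n<n j d))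

  h∣⇒period : ∀ {j} → d ∣ j → IsPeriod j
  h∣⇒period {j} d∣j = trans (2^≡2^[%h] j) (cong (λ z → 2 ^ z % N) (n∣m⇒m%n≡0 j d d∣j))

  N∣2^j∸1⇒h∣j : ∀ {j} → N ∣ 2 ^ j ∸ 1 → d ∣ j
  N∣2^j∸1⇒h∣j {j} N∣ = period⇒h∣ (∣∸⇒%≡% N (m^n>0 2 j) N∣)

  h∣j⇒N∣2^j∸1 : ∀ {j} → d ∣ j → N ∣ 2 ^ j ∸ 1
  h∣j⇒N∣2^j∸1 {j} d∣j = %≡%⇒∣∸ {2 ^ j} {1} N (h∣⇒period d∣j)

module Cosets (m : ℕ) (odd : Odd (suc m)) where

  open Order m odd public

  infixl 7 _·2^_
  _·2^_ : ℕ → ℕ → ℕ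
  x ·2^ i = x * 2 ^ i % N

  ·2^-+ : ∀ x j i → x ·2^ j ·2^ i ≡ x ·2^ (j + i)
  ·2^-+ x j i = begin
    x * 2 ^ j % N * 2 ^ i % N    ≡⟨ %-*-congˡ {x * 2 ^ j % N} {x * 2 ^ j} (2 ^ i) N (m%n%n≡m%n (x * 2 ^ j) N) ⟩
    x * 2 ^ j * 2 ^ i % N        ≡⟨ cong (_% N) (*-assoc x (2 ^ j) (2 ^ i)) ⟩
    x * (2 ^ j * 2 ^ i) % N      ≡⟨ cong (λ z → x * z % N) (^-distribˡ-+-* 2 j i) ⟨
    x * 2 ^ (j + i) % N          ∎

  ·2^-comm : ∀ x i j → x ·2^ i ·2^ j ≡ x ·2^ j ·2^ i
  ·2^-comm x i j = trans (·2^-+ x i j) (trans (cong (x ·2^_) (+-comm i j)) (sym (·2^-+ x j i)))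

  ·2^-%h : ∀ x i → x ·2^ i ≡ x ·2^ (i % d)
  ·2^-%h x i = %-*-congʳ x N (2^≡2^[%h] i)

  ·2^0 : ∀ {x} → x < N → x ·2^ 0 ≡ x
  ·2^0 {x} x<N = trans (cong (_% N) (*-identityʳ x)) (m<n⇒m%n≡m x<N)

  ·2^h : ∀ {x} → x < N → x ·2^ d ≡ x
  ·2^h {x} x<N = trans (·2^-%h x d) (trans (cong (x ·2^_) (n%n≡0 d)) (·2^0 x<N))

  ·2^-cancel : ∀ {x j} → j ≤ d → x < N → x ·2^ j ·2^ (d ∸ j) ≡ x
  ·2^-cancel {x} {j} j≤d x<N = trans (·2^-+ x j (d ∸ j)) (trans (cong (x ·2^_) (m+[n∸m]≡n j≤d)) (·2^h x<N))

  ·2^<N : ∀ x i → x ·2^ i < N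
  ·2^<N x i = m%n<n (x * 2 ^ i) N

  -- N is odd, so multiplication by 2 ^ i is invertible modulo N.
  ·2^-pos : ∀ {x} i → 1 ≤ x → x < N → 1 ≤ x ·2^ i
  ·2^-pos {x} i 1≤x x<N with x ·2^ i ≟ 0
  ... | no ≢0 = n≢0⇒n>0 ≢0
  ... | yes ≡0 = contradiction N∣x (0<m<n⇒n∤m 1≤x x<N)
    where
    N∣x : N ∣ x
    N∣x = coprime-∣-^* (odd⇒coprime-2 odd) i x (subst (N ∣_) (*-comm x (2 ^ i)) (m%n≡0⇒n∣m _ N ≡0))

  fixed⇒∣ : ∀ {x} i → x < N → x ·2^ i ≡ x → N ∣ x * (2 ^ i ∸ 1)
  fixed⇒∣ {x} i x<N fixed = subst (N ∣_) (sym (m*[n∸1]≡m*n∸m x (2 ^ i)))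
    (%≡%⇒∣∸ {x * 2 ^ i} {x} N (trans fixed (sym (m<n⇒m%n≡m x<N))))

  ∣⇒fixed : ∀ {x} i → x < N → N ∣ x * (2 ^ i ∸ 1) → x ·2^ i ≡ x
  ∣⇒fixed {x} i x<N N∣ = trans
    (∣∸⇒%≡% N (m≤m*n x (2 ^ i) {{m^n≢0 2 i}}) (subst (N ∣_) (m*[n∸1]≡m*n∸m x (2 ^ i)) N∣))
    (m<n⇒m%n≡m x<N)

  Free : Set
  Free = ∀ x i → 1 ≤ x → x < N → x ·2^ i ≡ x → d ∣ i

  free⇒·2^-injective-≤ : Free → ∀ {x i j} → 1 ≤ x → x < N → i ≤ j → j < d →
    x ·2^ i ≡ x ·2^ j → i ≡ j
  free⇒·2^-injective-≤ free {x} {i} {j} 1≤x x<N i≤j j<d e =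
    ≤-antisym i≤j (m∸n≡0⇒m≤n (∣∧<⇒≡0 d∣j∸i (≤-<-trans (m∸n≤m j i) j<d)))
    where
    fixed : x ·2^ i ·2^ (j ∸ i) ≡ x ·2^ i
    fixed = trans (·2^-+ x i (j ∸ i)) (trans (cong (x ·2^_) (m+[n∸m]≡n i≤j)) (sym e))
    d∣j∸i : d ∣ j ∸ i
    d∣j∸i = free (x ·2^ i) (j ∸ i) (·2^-pos i 1≤x x<N) (·2^<N x i) fixed

  free⇒·2^-injective : Free → ∀ {x i j} → 1 ≤ x → x < N → i < d → j < d →
    x ·2^ i ≡ x ·2^ j → i ≡ j
  free⇒·2^-injective free {i = i} {j} 1≤x x<N i<d j<d e with ≤-total i j
  ... | inj₁ i≤j = free⇒·2^-injective-≤ free 1≤x x<N i≤j j<d e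
  ... | inj₂ j≤i = sym (free⇒·2^-injective-≤ free 1≤x x<N j≤i i<d (sym e))

  coset≡ : ∀ x → coset N x ≡ map (x ·2^_) (upTo d)
  coset≡ x = cong (λ n → map (x ·2^_) (upTo n)) h≡d

  leader⇒≤·2^ : ∀ {x} → IsLeader N x → ∀ {i} → i < d → x ≤ x ·2^ i
  leader⇒≤·2^ {x} x-leader = All.applyUpTo⁻ (λ i → i) d (All.map⁻ (subst (All (x ≤_)) (coset≡ x) x-leader))

  ≤·2^⇒leader : ∀ {x} → (∀ {i} → i < d → x ≤ x ·2^ i) → IsLeader N x
  ≤·2^⇒leader {x} x≤ = subst (All (x ≤_)) (sym (coset≡ x)) (All.map⁺ (All.applyUpTo⁺₁ (λ i → i) d x≤))

  isLeader? : ∀ x → Dec (IsLeader N x)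
  isLeader? x = all? (x ≤?_) (coset N x)

  leaders : List ℕ
  leaders = filter isLeader? (map suc (upTo m))

  ∈leaders⁻ : ∀ {x} → x ∈ leaders → 1 ≤ x × x < N × IsLeader N x
  ∈leaders⁻ x∈ with x∈[1,m] , x-leader ← ∈-filter⁻ isLeader? {xs = map suc (upTo m)} x∈
                 with y , y∈ , refl ← ∈-map⁻ suc x∈[1,m] = s≤s z≤n , s≤s (∈-upTo⁻ y∈) , x-leader

  ∈leaders⁺ : ∀ {x} → 1 ≤ x → x < N → IsLeader N x → x ∈ leaders
  ∈leaders⁺ {suc y} _ (s≤s y<m) = ∈-filter⁺ isLeader? (∈-map⁺ suc (∈-upTo⁺ y<m))

  leaders-unique : Unique leaders
  leaders-unique = Unique.filter⁺ isLeader? (Unique.map⁺ suc-injective (Unique.upTo⁺ m))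

  leader-of : ∀ {x} → 1 ≤ x → x < N → ∃[ L ] L ∈ leaders × ∃[ k ] k < d × L ·2^ k ≡ x
  leader-of {x} 1≤x x<N =
    L , ∈leaders⁺ (subst (1 ≤_) xj≡L (·2^-pos j 1≤x x<N)) (subst (_< N) xj≡L (·2^<N x j)) L-leader ,
    (d ∸ j) % d , m%n<n (d ∸ j) d ,
    trans (sym (·2^-%h L (d ∸ j))) (subst (λ z → z ·2^ (d ∸ j) ≡ x) xj≡L (·2^-cancel (<⇒≤ j<d) x<N))
    where
    L : ℕ
    L = min x (map (x ·2^_) (upTo d))
    in-coset : ∃[ j ] j < d × x ·2^ j ≡ L
    in-coset = argmin-all (λ y → y) {P = λ y → ∃[ j ] j < d × x ·2^ j ≡ y} (0 , 0<h , ·2^0 x<N)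
      (All.map⁺ (All.applyUpTo⁺₁ (λ i → i) d (λ {j} j<d → j , j<d , refl)))
    j = proj₁ in-coset
    j<d = proj₁ (proj₂ in-coset)
    xj≡L = proj₂ (proj₂ in-coset)
    L-leader : IsLeader N L
    L-leader = ≤·2^⇒leader λ {i} _ → subst (L ≤_)
      (begin
        x ·2^ ((j + i) % d) ≡⟨ ·2^-%h x (j + i) ⟨
        x ·2^ (j + i)       ≡⟨ ·2^-+ x j i ⟨
        x ·2^ j ·2^ i       ≡⟨ cong (_·2^ i) xj≡L ⟩
        L ·2^ i             ∎)
      (All.applyUpTo⁻ (λ i → i) d (All.map⁻ (min≤xs x (map (x ·2^_) (upTo d)))) (m%n<n (j + i) d))

  leader-≤ : ∀ {L y i j} → IsLeader N L → y < N → i < d → j ≤ d → L ·2^ i ≡ y ·2^ j → L ≤ y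
  leader-≤ {L} {y} {i} {j} L-leader y<N i<d j≤d e =
    subst (L ≤_) L·2^k≡y (leader⇒≤·2^ L-leader (m%n<n (i + (d ∸ j)) d))
    where
    L·2^k≡y : L ·2^ ((i + (d ∸ j)) % d) ≡ y
    L·2^k≡y = begin
      L ·2^ ((i + (d ∸ j)) % d)  ≡⟨ ·2^-%h L (i + (d ∸ j)) ⟨
      L ·2^ (i + (d ∸ j))        ≡⟨ ·2^-+ L i (d ∸ j) ⟨
      L ·2^ i ·2^ (d ∸ j)        ≡⟨ cong (_·2^ (d ∸ j)) e ⟩
      y ·2^ j ·2^ (d ∸ j)        ≡⟨ ·2^-cancel j≤d y<N ⟩
      y                          ∎

  leaders-disjoint : ∀ {L L' i j} → IsLeader N L → IsLeader N L' → L < N → L' < N →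
    i < d → j < d → L ·2^ i ≡ L' ·2^ j → L ≡ L'
  leaders-disjoint L-leader L'-leader L<N L'<N i<d j<d e =
    ≤-antisym (leader-≤ L-leader L'<N i<d (<⇒≤ j<d) e) (leader-≤ L'-leader L<N j<d (<⇒≤ i<d) (sym e))

  nonzeroResidue : ∀ {x} → 1 ≤ x → x < N → Fin m
  nonzeroResidue {suc x} _ x<N = fromℕ< (s<s⁻¹ x<N)

  suc-toℕ-nonzeroResidue : ∀ {x} (1≤x : 1 ≤ x) (x<N : x < N) → suc (toℕ (nonzeroResidue 1≤x x<N)) ≡ x
  suc-toℕ-nonzeroResidue {suc x} _ x<N = cong suc (toℕ-fromℕ< (s<s⁻¹ x<N))

  leader : Fin (r N) → ℕ
  leader = lookup leaders

  leader-pos : ∀ ℓ → 1 ≤ leader ℓ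
  leader-pos ℓ = proj₁ (∈leaders⁻ (∈-lookup ℓ))

  leader<N : ∀ ℓ → leader ℓ < N
  leader<N ℓ = proj₁ (proj₂ (∈leaders⁻ (∈-lookup ℓ)))

  leader-isLeader : ∀ ℓ → IsLeader N (leader ℓ)
  leader-isLeader ℓ = proj₂ (proj₂ (∈leaders⁻ (∈-lookup ℓ)))

  point : Fin (r N) × Fin d → ℕ
  point (ℓ , k) = leader ℓ ·2^ toℕ k

  point-pos : ∀ c → 1 ≤ point c
  point-pos (ℓ , k) = ·2^-pos (toℕ k) (leader-pos ℓ) (leader<N ℓ)

  point<N : ∀ c → point c < N
  point<N (ℓ , k) = ·2^<N (leader ℓ) (toℕ k)

  residue : Fin (r N) × Fin d → Fin m
  residue c = nonzeroResidue (point-pos c) (point<N c)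

  point-surjective : ∀ {x} → 1 ≤ x → x < N → ∃[ c ] point c ≡ x
  point-surjective 1≤x x<N =
    let L , L∈ , k , k<d , L·2^k≡x = leader-of 1≤x x<N
    in (index L∈ , fromℕ< k<d) , trans (cong₂ _·2^_ (sym (lookup-index L∈)) (toℕ-fromℕ< k<d)) L·2^k≡x

  suc-toℕ-residue : ∀ c → suc (toℕ (residue c)) ≡ point c
  suc-toℕ-residue c = suc-toℕ-nonzeroResidue (point-pos c) (point<N c)

  residue≡⇒point≡ : ∀ {c c'} → residue c ≡ residue c' → point c ≡ point c'
  residue≡⇒point≡ {c} {c'} e =
    trans (sym (suc-toℕ-residue c)) (trans (cong (suc ∘ toℕ) e) (suc-toℕ-residue c'))

  point≡⇒residue≡ : ∀ {c c'} → point c ≡ point c' → residue c ≡ residue c'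
  point≡⇒residue≡ {c} {c'} e =
    toℕ-injective (suc-injective (trans (suc-toℕ-residue c) (trans e (sym (suc-toℕ-residue c')))))

  orbit : Fin (r N * d) → Fin m
  orbit = residue ∘ remQuot d

  orbit-combine : ∀ ℓ k → orbit (combine ℓ k) ≡ residue (ℓ , k)
  orbit-combine ℓ k = cong residue (remQuot-combine ℓ k)

  orbit-surjective : ∀ y → ∃[ c ] orbit c ≡ y
  orbit-surjective y =
    let (ℓ , k) , point≡1+y = point-surjective {suc (toℕ y)} (s≤s z≤n) (s≤s (toℕ<n y))
    in combine ℓ k , toℕ-injective (suc-injective (begin
      suc (toℕ (orbit (combine ℓ k)))  ≡⟨ cong (suc ∘ toℕ) (orbit-combine ℓ k) ⟩
      suc (toℕ (residue (ℓ , k)))      ≡⟨ suc-toℕ-residue (ℓ , k) ⟩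
      point (ℓ , k)                    ≡⟨ point≡1+y ⟩
      suc (toℕ y)                      ∎))

  free⇒residue-injective : Free → ∀ {c c'} → residue c ≡ residue c' → c ≡ c'
  free⇒residue-injective free {ℓ , k} {ℓ' , k'} e = cong₂ _,_ ℓ≡ℓ' (toℕ-injective k≡k')
    where
    Lk≡L'k' : leader ℓ ·2^ toℕ k ≡ leader ℓ' ·2^ toℕ k'
    Lk≡L'k' = residue≡⇒point≡ e
    ℓ≡ℓ' : ℓ ≡ ℓ'
    ℓ≡ℓ' = lookup-injective leaders-unique
      (leaders-disjoint (leader-isLeader ℓ) (leader-isLeader ℓ') (leader<N ℓ) (leader<N ℓ')
        (toℕ<n k) (toℕ<n k') Lk≡L'k')
    k≡k' : toℕ k ≡ toℕ k'
    k≡k' = free⇒·2^-injective free (leader-pos ℓ) (leader<N ℓ) (toℕ<n k) (toℕ<n k')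
      (trans Lk≡L'k' (cong (λ ℓ → leader ℓ ·2^ toℕ k') (sym ℓ≡ℓ')))

  -- If 2 ^ i fixes x then it fixes the leader of its coset, so (ℓ , 0) and (ℓ , i) have the same point.
  fixed⇒m<r*h : ∀ {x i} → 1 ≤ x → x < N → 0 < i → i < d → x ·2^ i ≡ x → m < r N * d
  fixed⇒m<r*h {x} {i} 1≤x x<N 0<i i<d fixed =
    surjective∧collision⇒< orbit orbit-surjective (k₀≢kᵢ ∘ cong proj₂ ∘ combine-injective)
      (trans (orbit-combine ℓ k₀) (trans (point≡⇒residue≡ point≡) (sym (orbit-combine ℓ kᵢ))))
    where
    c = proj₁ (point-surjective 1≤x x<N)
    ℓ = proj₁ c
    k = proj₂ c
    L = leader ℓ
    x·2^[d∸k]≡L : x ·2^ (d ∸ toℕ k) ≡ L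
    x·2^[d∸k]≡L = trans (cong (_·2^ (d ∸ toℕ k)) (sym (proj₂ (point-surjective 1≤x x<N))))
      (·2^-cancel (<⇒≤ (toℕ<n k)) (leader<N ℓ))
    L-fixed : L ·2^ i ≡ L
    L-fixed = begin
      L ·2^ i                    ≡⟨ cong (_·2^ i) x·2^[d∸k]≡L ⟨
      x ·2^ (d ∸ toℕ k) ·2^ i    ≡⟨ ·2^-comm x (d ∸ toℕ k) i ⟩
      x ·2^ i ·2^ (d ∸ toℕ k)    ≡⟨ cong (_·2^ (d ∸ toℕ k)) fixed ⟩
      x ·2^ (d ∸ toℕ k)          ≡⟨ x·2^[d∸k]≡L ⟩
      L                          ∎
    k₀ = fromℕ< 0<h
    kᵢ = fromℕ< i<d
    point≡ : point (ℓ , k₀) ≡ point (ℓ , kᵢ)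
    point≡ = begin
      L ·2^ toℕ k₀  ≡⟨ cong (L ·2^_) (toℕ-fromℕ< 0<h) ⟩
      L ·2^ 0       ≡⟨ ·2^0 (leader<N ℓ) ⟩
      L             ≡⟨ L-fixed ⟨
      L ·2^ i       ≡⟨ cong (L ·2^_) (toℕ-fromℕ< i<d) ⟨
      L ·2^ toℕ kᵢ  ∎
    k₀≢kᵢ : k₀ ≢ kᵢ
    k₀≢kᵢ k₀≡kᵢ =
      <⇒≢ 0<i (trans (sym (toℕ-fromℕ< 0<h)) (trans (cong toℕ k₀≡kᵢ) (toℕ-fromℕ< i<d)))
    combine-injective : combine ℓ k₀ ≡ combine ℓ kᵢ → (ℓ , k₀) ≡ (ℓ , kᵢ)
    combine-injective e = trans (sym (remQuot-combine ℓ k₀)) (trans (cong (remQuot d) e) (remQuot-combine ℓ kᵢ))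

  N≡r*h+1⇔m≡r*h : N ≡ r N * h N + 1 ⇔ m ≡ r N * d
  N≡r*h+1⇔m≡r*h = mk⇔
    (λ e → suc-injective (trans e (trans (+-comm _ 1) (cong (λ n → suc (r N * n)) h≡d))))
    (λ e → trans (cong suc e) (trans (cong (λ n → suc (r N * n)) (sym h≡d)) (+-comm 1 _)))

  m≤r*h : m ≤ r N * d
  m≤r*h = surjective⇒≤ orbit orbit-surjective

  free⇒m≡r*h : Free → m ≡ r N * d
  free⇒m≡r*h free = ≤-antisym m≤r*h (injective⇒≤ (remQuot-injective d ∘ free⇒residue-injective free))

  m≡r*h⇒free : m ≡ r N * d → Free
  m≡r*h⇒free m≡r*h x i 1≤x x<N fixed with i % d ≟ 0
  ... | yes i%d≡0 = m%n≡0⇒n∣m i d i%d≡0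
  ... | no i%d≢0 = contradiction m≡r*h
    (<⇒≢ (fixed⇒m<r*h 1≤x x<N (n≢0⇒n>0 i%d≢0) (m%n<n i d) (trans (sym (·2^-%h x i)) fixed)))

-- Modulo a prime every nonzero residue has trivial stabiliser, so h(p) divides p − 1 = r(p) · h(p).
fermat : ∀ {p} → Prime p → Odd p → p ∣ 2 ^ (p ∸ 1) ∸ 1
fermat {zero} pr _ = contradiction pr ¬prime[0]
fermat {suc m} pr odd = h∣j⇒N∣2^j∸1 (divides (r N) (free⇒m≡r*h free))
  where
  open Cosets m odd
  free : Free
  free x i 1≤x x<N fixed with euclidsLemma x (2 ^ i ∸ 1) pr (fixed⇒∣ i x<N fixed)
  ... | inj₁ p∣x = contradiction p∣x (0<m<n⇒n∤m 1≤x x<N)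
  ... | inj₂ p∣2^i∸1 = N∣2^j∸1⇒h∣j p∣2^i∸1

module PrimePower (p w : ℕ) (pr : Prime p) (odd-p : Odd p) where

  instance
    p-nonZero : NonZero p
    p-nonZero = prime⇒nonZero pr

  m : ℕ
  m = p ^ (w + 1) ∸ 1

  p^[w+1]≡1+m : p ^ (w + 1) ≡ suc m
  p^[w+1]≡1+m = sym (m+[n∸m]≡n (m^n>0 p (w + 1)))

  odd-N : Odd (suc m)
  odd-N = subst Odd p^[w+1]≡1+m (odd-^ (w + 1) odd-p)

  open Cosets m odd-N public

  p*p^w≡N : p * p ^ w ≡ N
  p*p^w≡N = trans (cong (p ^_) (+-comm 1 w)) p^[w+1]≡1+m

  1<p : 1 < p
  1<p = nonTrivial⇒n>1 p {{prime⇒nonTrivial pr}}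

  composite-N : 1 ≤ w → Composite N
  composite-N (s≤s {n = w'} _) =
    composite-≢ p {{prime⇒nonTrivial pr}} (<⇒≢ p<N) (subst (p ∣_) p*p^w≡N (m∣m*n (p ^ w)))
    where
    p<N : p < N
    p<N = subst (p <_) p*p^w≡N (m<m*n p (p ^ w) (<-≤-trans 1<p (m≤m*n p (p ^ w') {{m^n≢0 p w'}})))

  wieferich⇒free : N ∣ 2 ^ (p ∸ 1) ∸ 1 → Free
  wieferich⇒free N∣2^[p∸1]∸1 x i 1≤x x<N fixed = coprime-∣-^* d⊥p w i (subst (d ∣_) (*-comm i (p ^ w)) d∣i*p^w)
    where
    d⊥p : Coprime d p
    d⊥p = ∣pred⇒coprime pr (N∣2^j∸1⇒h∣j N∣2^[p∸1]∸1)
    p^[w+1]∣x*[2^i∸1] : p ^ suc w ∣ x * (2 ^ i ∸ 1)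
    p^[w+1]∣x*[2^i∸1] = subst (_∣ x * (2 ^ i ∸ 1)) (sym p*p^w≡N) (fixed⇒∣ i x<N fixed)
    p∣2^i∸1 : p ∣ 2 ^ i ∸ 1
    p∣2^i∸1 with p ∣? 2 ^ i ∸ 1
    ... | yes p∣ = p∣
    ... | no p∤ = contradiction (subst (_∣ x) p*p^w≡N (prime^-∣-*-cancelʳ pr (suc w) x _ p^[w+1]∣x*[2^i∸1] p∤))
      (0<m<n⇒n∤m 1≤x x<N)
    d∣i*p^w : d ∣ i * p ^ w
    d∣i*p^w = N∣2^j∸1⇒h∣j (subst₂ (λ a b → a ∣ b ∸ 1) p*p^w≡N (^-*-assoc 2 i (p ^ w)) (lift-∣ w (m^n>0 2 i) p∣2^i∸1))

  free⇒wieferich : Free → N ∣ 2 ^ (p ∸ 1) ∸ 1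
  free⇒wieferich free =
    h∣j⇒N∣2^j∸1 (free (p ^ w) (p ∸ 1) (m^n>0 p w) p^w<N (∣⇒fixed (p ∸ 1) p^w<N N∣p^w*[2^[p∸1]∸1]))
    where
    p^w*p≡N : p ^ w * p ≡ N
    p^w*p≡N = trans (*-comm (p ^ w) p) p*p^w≡N
    p^w<N : p ^ w < N
    p^w<N = subst (p ^ w <_) p^w*p≡N (m<m*n (p ^ w) p {{m^n≢0 p w}} 1<p)
    N∣p^w*[2^[p∸1]∸1] : N ∣ p ^ w * (2 ^ (p ∸ 1) ∸ 1)
    N∣p^w*[2^[p∸1]∸1] =
      subst (_∣ p ^ w * (2 ^ (p ∸ 1) ∸ 1)) p^w*p≡N (*-monoʳ-∣ (p ^ w) (fermat pr odd-p))

theorem4 : (p w : ℕ) → Prime p → Odd p → 1 ≤ w →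
    ((p ^ (w + 1)) ∣ (2 ^ (p ∸ 1) ∸ 1)) ⇔ OverPseudoprime2 (p ^ (w + 1))
theorem4 p w pr odd-p 1≤w =
  subst (λ n → (n ∣ 2 ^ (p ∸ 1) ∸ 1) ⇔ OverPseudoprime2 n) (sym p^[w+1]≡1+m) (mk⇔
    (λ wieferich → odd-N , composite-N 1≤w ,
      N≡r*h+1⇔m≡r*h .Equivalence.from (free⇒m≡r*h (wieferich⇒free wieferich)))
    (λ (_ , _ , N≡r*h+1) → free⇒wieferich (m≡r*h⇒free (N≡r*h+1⇔m≡r*h .Equivalence.to N≡r*h+1))))
  where
  open PrimePower p w pr odd-p
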